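{- Let $\mathbf{S}$ be a meta-string (a string over an alphabet of meta-characters) and let $(V,E,G)$ be its packed DAWG. Then the total number of elements of $\mathit{Points}_{[u]}$ over all states $[u]\in V$ is $O(\|\mathbf{S}\|)$, where $\|\mathbf{S}\|$ is the length of $\mathbf{S}$.
   Context: For a string $T$ and a substring $u$ of $T$, let $\mathit{EndPos}_T(u)=\{j\mid u=T[i..j]\}$. Substrings $u,w$ of $T$ are equivalent, $u\equiv w$, iff $\mathit{EndPos}_T(u)=\mathit{EndPos}_T(w)$; $[u]$ denotes the equivalence class and $\overrightarrow{u}$ its longest member. The DAWG of $T$ has states $V=\{[u]\mid u\in\mathit{Substr}(T)\}$, edges $E=\{([u],a,[ua])\mid u,ua\in\mathit{Substr}(T),\ u\not\equiv ua\}$ (labeled by a single character $a$), and suffix links $G=\{([au],a,[u])\mid u,au\in\mathit{Substr}(T),\ u=\overrightarrow{u}\}$. The packed DAWG of a meta-string $\mathbf{S}$ is the DAWG of $\mathbf{S}$ viewed as a string over the meta-character alphabet. For a meta-character $A$ (a string of $r$ characters), $\overline{A}$ denotes its reversal. For each state $[u]$, $\mathit{Points}_{[u]}=\{(\overline{A},X)\mid ([u],X,[uX])\in E,\ A\overrightarrow{u}X\in\mathit{Substr}(\mathbf{S})\}$, where $A,X$ are meta-characters. -}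

module Defs where

open import Data.Nat using (ℕ; _≤_; _*_; _+_)
open import Data.List using (List; []; _∷_; _++_; take; length)
open import Data.Vec using (Vec; reverse)
open import Data.Product using (Σ; ∃; _×_; _,_)
open import Relation.Nullary using (¬_)
open import Relation.Binary.PropositionalEquality using (_≡_)

MetaChar : Set → ℕ → Set
MetaChar A r = Vec A r

MetaString : Set → ℕ → Set
MetaString A r = List (MetaChar A r)

module _ {C : Set} where

  Substr : List C → List C → Set
  Substr T u = ∃ λ pre → ∃ λ suf → T ≡ pre ++ (u ++ suf)

  -- j ∈ EndPos_T(u): u = T[i..j] for some i (1-indexed, j ∈ {0..|T|},
  -- i.e. u is a suffix of the length-j prefix of T).
  EndPos : List C → List C → ℕ → Set
  EndPos T u j = j ≤ length T × (∃ λ pre → take j T ≡ pre ++ u)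

  Equiv : List C → List C → List C → Set
  Equiv T u w = ∀ j → (EndPos T u j → EndPos T w j) × (EndPos T w j → EndPos T u j)

  -- u is the longest member of its equivalence class, i.e. u = →u.
  -- States [u] of the DAWG are represented by these canonical members.
  IsLongest : List C → List C → Set
  IsLongest T u = Substr T u × (∀ w → Equiv T u w → length w ≤ length u)

  InE : List C → List C → C → Set
  InE T u a = ∃ λ v →
      Substr T v × Substr T (v ++ (a ∷ [])) × ¬ Equiv T v (v ++ (a ∷ []))
    × Equiv T v u × Equiv T (v ++ (a ∷ [])) (u ++ (a ∷ []))

-- (Ā', X) ∈ Points_[u]  for the packed DAWG of the meta-string S
-- (u is a representative of the state; in the total count we take u = →u).
InPoints : {A : Set} {r : ℕ} → MetaString A r → MetaString A r
         → MetaChar A r → MetaChar A r → Set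
InPoints S u A' X = ∃ λ A → A' ≡ reverse A × InE S u X
                          × Substr S (A ∷ (u ++ (X ∷ [])))

-- Elements of the disjoint union over all states [u] ∈ V of Points_[u]:
-- triples (→u, Ā, X) with (Ā, X) ∈ Points_[u].
PointsTotal : {A : Set} {r : ℕ} → MetaString A r
            → List (MetaChar A r) × MetaChar A r × MetaChar A r → Set
PointsTotal S (u , A' , X) = IsLongest S u × InPoints S u A' X

module Submission where

-- Write m = u X. Each point (Ā, X) of a state u = →u is charged to one of the ‖S‖ + 1 positions of S,
-- with one of three tags, and the charge is injective.
-- If every occurrence of m is preceded by A, charge the start of an occurrence of m. Two triples
-- charged there would make the shorter m a prefix of the longer u', so every occurrence of u' would
-- be preceded by one character, and u' would not be the longest member of its class.
-- Otherwise, charge the end of the last occurrence of m whose A-precededness differs from that of the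
-- very last occurrence of m, tagged by the latter. If m' = y c m were charged to the same end, m is
-- preceded by c both there and at the last occurrence of m', so the latter is a switch of m too; being
-- no earlier, it is the charged occurrence itself, where m' cannot differ from itself.
-- Minima and case distinctions are classical; they are taken in the double-negation monad, which
-- suffices because the conclusion is a decidable inequality.

open import Defs
open import Data.Bool using (Bool; true; false; not)
open import Data.Empty using (⊥-elim)
open import Data.Fin using (Fin; zero; suc; toℕ; fromℕ<; combine)
open import Data.Fin.Properties using (pigeonhole; <⇒≢; combine-injective; toℕ-fromℕ<)
import Data.Fin.Properties as Fin
open import Data.List using (List; []; _∷_; _++_; _∷ʳ_; length; lookup; take; drop; initLast; _∷ʳ′_)
open import Data.List.Properties
  using (length-++-≤ʳ; ++-assoc; ++-identityʳ; ++-cancelʳ; ∷-injectiveˡ; ∷-injectiveʳ; ∷ʳ-injective; take++drop≡id)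
open import Data.List.Membership.Propositional.Properties using (∈-lookup)
open import Data.List.Relation.Unary.All as All using (All)
open import Data.List.Relation.Unary.AllPairs using (_∷_)
open import Data.List.Relation.Unary.Unique.Propositional using (Unique)
open import Data.Nat using (ℕ; suc; _+_; _*_; _≤_; _<_; _≤?_; s≤s)
open import Data.Nat.Induction using (<-rec)
open import Data.Nat.Properties
  using (≤-trans; ≤-antisym; ≤-reflexive; ≤-total; ≰⇒>; ≮⇒≥; 1+n≰n; +-comm; *-suc)
open import Data.Product using (∃; ∃₂; _×_; _,_; proj₁; proj₂; uncurry)
open import Data.Sum using (inj₁; inj₂)
open import Data.Vec using (reverse)
open import Effect.Monad using (RawMonad)
open import Function using (_∘_; const)
open import Relation.Nullary using (¬_; yes; no)
open import Relation.Nullary.Decidable using (decidable-stable; ¬¬-excluded-middle)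
open import Relation.Nullary.Negation using (¬¬-Monad; ¬¬-map; contradiction)
open import Relation.Binary.PropositionalEquality
open import Level using (0ℓ)

open RawMonad (¬¬-Monad {0ℓ}) using (_>>=_; pure; rawApplicative)

¬¬-→ : {A B : Set} → (A → ¬ ¬ B) → ¬ ¬ (A → B)
¬¬-→ f ¬[A→B] = ¬[A→B] (λ a → ⊥-elim (f a (¬[A→B] ∘ const)))

¬¬-∀≤ : {P : ℕ → Set} (n : ℕ) → (∀ j → ¬ ¬ P j) → ¬ ¬ (∀ j → j ≤ n → P j)
¬¬-∀≤ {P} n h = ¬¬-map at (Fin.sequence rawApplicative (h ∘ toℕ {suc n}))
  where
    at : (∀ (i : Fin (suc n)) → P (toℕ i)) → ∀ j → j ≤ n → P j
    at all j j≤n = subst P (toℕ-fromℕ< (s≤s j≤n)) (all (fromℕ< (s≤s j≤n)))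

Least : (ℕ → Set) → ℕ → Set
Least P n = P n × (∀ {m} → P m → n ≤ m)

¬¬-least : (P : ℕ → Set) {n : ℕ} → P n → ¬ ¬ ∃ (Least P)
¬¬-least P {n} = <-rec (λ n → P n → ¬ ¬ ∃ (Least P)) step n
  where
    step : ∀ n → (∀ {m} → m < n → P m → ¬ ¬ ∃ (Least P)) → P n → ¬ ¬ ∃ (Least P)
    step n rec pn = ¬¬-excluded-middle {A = ∃ λ m → m < n × P m} >>= λ where
      (yes (m , m<n , pm)) → rec m<n pm
      (no ∄smaller) → pure (n , pn , λ {m} pm → ≮⇒≥ (λ m<n → ∄smaller (m , m<n , pm)))

module _ {X : Set} where

  lookup-injective : {L : List X} → Unique L → ∀ i j → lookup L i ≡ lookup L j → i ≡ j
  lookup-injective (_ ∷ _) zero zero _ = refl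
  lookup-injective (x∉ ∷ _) zero (suc j) eq = contradiction eq (All.lookup x∉ (∈-lookup j))
  lookup-injective (x∉ ∷ _) (suc i) zero eq = contradiction (sym eq) (All.lookup x∉ (∈-lookup i))
  lookup-injective (_ ∷ unique) (suc i) (suc j) eq = cong suc (lookup-injective unique i j eq)

  module _ {N : ℕ} (R : X → Fin N → Set) (R-injective : ∀ {x y i} → R x i → R y i → ¬ ¬ x ≡ y) where

    ¬¬-length≤-pigeonhole : {L : List X} → Unique L → All (∃ ∘ R) L → ¬ ¬ length L ≤ N
    ¬¬-length≤-pigeonhole {L} unique codes L≰N =
      let i , j , i<j , same = pigeonhole (≰⇒> L≰N) (proj₁ ∘ code) in
      R-injective (proj₂ (code i)) (subst (R _) (sym same) (proj₂ (code j)))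
        (<⇒≢ i<j ∘ lookup-injective unique i j)
      where
        code : (i : Fin (length L)) → ∃ (R (lookup L i))
        code i = All.lookup codes (∈-lookup i)

    length≤-coding : {L : List X} → Unique L → All (λ x → ¬ ¬ ∃ (R x)) L → length L ≤ N
    length≤-coding {L} unique codes =
      decidable-stable (length L ≤? N) (All.sequenceM _ ¬¬-Monad codes >>= ¬¬-length≤-pigeonhole unique)

module _ {C : Set} where

  ++-suffix-split : ∀ (p s q t : List C) → p ++ s ≡ q ++ t → length s ≤ length t → ∃ λ y → t ≡ y ++ s
  ++-suffix-split p s [] t eq _ = p , sym eq
  ++-suffix-split [] s (c ∷ q) t refl s≤t = contradiction (≤-trans (s≤s (length-++-≤ʳ t {q})) s≤t) 1+n≰n
  ++-suffix-split (d ∷ p) s (c ∷ q) t eq s≤t = ++-suffix-split p s q t (∷-injectiveʳ eq) s≤t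

  ++-prefix-split : ∀ (x s y t : List C) → x ++ s ≡ y ++ t → length x ≤ length y → ∃ λ z → y ≡ x ++ z
  ++-prefix-split [] s y t _ _ = y , refl
  ++-prefix-split (c ∷ x) s (d ∷ y) t eq (s≤s x≤y) with refl ← ∷-injectiveˡ eq =
    let z , y≡x++z = ++-prefix-split x s y t (∷-injectiveʳ eq) x≤y in z , cong (c ∷_) y≡x++z

  ∷ʳ-triple-≡ : ∀ {u u' : List C} {a a' x x'} → a ≡ a' → u ∷ʳ x ≡ u' ∷ʳ x'
              → _≡_ {A = List C × C × C} (u , a , x) (u' , a' , x')
  ∷ʳ-triple-≡ {u} {u'} refl ux≡u'x' with refl , refl ← ∷ʳ-injective u u' ux≡u'x' = refl

  ++-length-≡ : ∀ (y s : List C) → length (y ++ s) ≡ length s → y ≡ []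
  ++-length-≡ [] s _ = refl
  ++-length-≡ (c ∷ y) s eq = contradiction (≤-trans (s≤s (length-++-≤ʳ s {y})) (≤-reflexive eq)) 1+n≰n

  Shortest : (List C → Set) → List C → Set
  Shortest P s = P s × (∀ {s'} → P s' → length s ≤ length s')

  ¬¬-shortest : (P : List C → Set) {s : List C} → P s → ¬ ¬ ∃ (Shortest P)
  ¬¬-shortest P {s} ps = ¬¬-map shortest (¬¬-least (λ n → ∃ λ s → length s ≡ n × P s) (s , refl , ps))
    where
      shortest : ∃ (Least (λ n → ∃ λ s → length s ≡ n × P s)) → ∃ (Shortest P)
      shortest (_ , (s , refl , ps) , least) = s , ps , λ ps' → least (_ , refl , ps')

module Occurrences {C : Set} (T : List C) where

  IsSuffix : List C → Set
  IsSuffix s = ∃ λ p → T ≡ p ++ s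

  -- An occurrence of w in T, identified by its right context s.
  record Occ (w s : List C) : Set where
    constructor at
    field
      prefix : List C
      splits : T ≡ prefix ++ w ++ s

  occ-isSuffix : ∀ {w s} → Occ w s → IsSuffix (w ++ s)
  occ-isSuffix (at p eq) = p , eq

  suffix-unique : ∀ {s t} → IsSuffix s → IsSuffix t → length s ≡ length t → s ≡ t
  suffix-unique {s} {t} (p , T≡p++s) (q , T≡q++t) |s|≡|t|
    with y , refl ← ++-suffix-split p s q t (trans (sym T≡p++s) T≡q++t) (≤-reflexive |s|≡|t|)
    with refl ← ++-length-≡ y s (sym |s|≡|t|) = refl

  occ-suffix : ∀ {w s} → Occ w s → IsSuffix s
  occ-suffix {w} {s} (at p eq) = p ++ w , trans eq (sym (++-assoc p w s))

  occ-dropˡ : ∀ y {w s} → Occ (y ++ w) s → Occ w s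
  occ-dropˡ y {w} {s} (at p eq) =
    at (p ++ y) (trans eq (trans (cong (p ++_) (++-assoc y w s)) (sym (++-assoc p y (w ++ s)))))

  occ-splitʳ : ∀ {w} z {s} → Occ (w ++ z) s → Occ w (z ++ s)
  occ-splitʳ {w} z {s} (at p eq) = at p (trans eq (cong (p ++_) (++-assoc w z s)))

  occ-joinʳ : ∀ {w} z {s} → Occ w (z ++ s) → Occ (w ++ z) s
  occ-joinʳ {w} z {s} (at p eq) = at p (trans eq (cong (p ++_) (sym (++-assoc w z s))))

  occ-length≤ : ∀ {w s} → Occ w s → length (w ++ s) ≤ length T
  occ-length≤ {w} {s} (at p refl) = length-++-≤ʳ (w ++ s) {p}

  left-context-unique : ∀ {a b w s} → Occ (a ∷ w) s → Occ (b ∷ w) s → a ≡ b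
  left-context-unique o o' = ∷-injectiveˡ (suffix-unique (occ-isSuffix o) (occ-isSuffix o') refl)

  occ-end-align : ∀ {w s w' s'} → Occ w s → Occ w' s' → length s ≡ length s' → length w ≤ length w'
                → s ≡ s' × ∃ λ y → w' ≡ y ++ w
  occ-end-align {w} {s} {w'} {s'} o@(at p eq) o'@(at p' eq') |s|≡|s'| |w|≤|w'|
    with refl ← suffix-unique (occ-suffix o) (occ-suffix o') |s|≡|s'| =
    refl , ++-suffix-split p w p' w' (++-cancelʳ s (p ++ w) (p' ++ w') same) |w|≤|w'|
    where
      same : (p ++ w) ++ s ≡ (p' ++ w') ++ s
      same = trans (++-assoc p w s) (trans (sym eq) (trans eq' (sym (++-assoc p' w' s))))

  occ-start-align : ∀ {w s w' s'} → Occ w s → Occ w' s' → length (w ++ s) ≡ length (w' ++ s') → length w ≤ length w'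
                  → ∃ λ z → w' ≡ w ++ z
  occ-start-align {w} {s} {w'} {s'} o o' same-start |w|≤|w'| =
    ++-prefix-split w s w' s' (suffix-unique (occ-isSuffix o) (occ-isSuffix o') same-start) |w|≤|w'|

  endPos⇒occ : ∀ {w j} → EndPos T w j → Occ w (drop j T)
  endPos⇒occ {w} {j} (_ , p , take≡p++w) =
    at p (trans (sym (take++drop≡id j T)) (trans (cong (_++ drop j T) take≡p++w) (++-assoc p w (drop j T))))

  occ⇒endPos : ∀ {w j} → j ≤ length T → Occ w (drop j T) → EndPos T w j
  occ⇒endPos {w} {j} j≤|T| (at p eq) = j≤|T| , p , ++-cancelʳ (drop j T) (take j T) (p ++ w)
    (trans (take++drop≡id j T) (trans eq (sym (++-assoc p w (drop j T)))))

  endPos-∷ : ∀ {a w j} → EndPos T (a ∷ w) j → EndPos T w j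
  endPos-∷ {a} {w} (j≤|T| , p , eq) = j≤|T| , p ++ a ∷ [] , trans eq (sym (++-assoc p (a ∷ []) w))

  Preceded : C → List C → Set
  Preceded a w = ∀ {s} → Occ w s → ¬ ¬ Occ (a ∷ w) s

  preceded-++ʳ : ∀ {a w} z → Preceded a w → Preceded a (w ++ z)
  preceded-++ʳ {a} {w} z preceded o = ¬¬-map (occ-joinʳ {a ∷ w} z) (preceded (occ-splitʳ {w} z o))

  longest⇒¬preceded : ∀ {a u} → IsLongest T u → ¬ Preceded a u
  longest⇒¬preceded {a} {u} (_ , longest) preceded =
    ¬¬-∀≤ (length T) (λ j → ¬¬-→ (extend j)) (λ ext → 1+n≰n (longest (a ∷ u) (equiv ext)))
    where
      extend : ∀ j → EndPos T u j → ¬ ¬ EndPos T (a ∷ u) j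
      extend j e = ¬¬-map (occ⇒endPos (proj₁ e)) (preceded (endPos⇒occ e))
      equiv : (∀ j → j ≤ length T → EndPos T u j → EndPos T (a ∷ u) j) → Equiv T u (a ∷ u)
      equiv ext j = (λ e → ext j (proj₁ e) e) , endPos-∷

  PrecededIf : Bool → C → List C → List C → Set
  PrecededIf true a w s = Occ (a ∷ w) s
  PrecededIf false a w s = ¬ Occ (a ∷ w) s

  precededIf-not : ∀ b {a w s} → PrecededIf b a w s → ¬ PrecededIf (not b) a w s
  precededIf-not true o ¬o = ¬o o
  precededIf-not false ¬o o = ¬o o

  precededIf-transport : ∀ b {a c w s s'} → Occ (c ∷ w) s → Occ (c ∷ w) s' → PrecededIf b a w s → PrecededIf b a w s'
  precededIf-transport true oc oc' o = subst (λ a → Occ (a ∷ _) _) (left-context-unique oc o) oc'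
  precededIf-transport false oc oc' ¬o o = ¬o (subst (λ a → Occ (a ∷ _) _) (left-context-unique oc' o) oc)

  -- Reading the occurrences of w from right to left, k is the right-context length of the first one
  -- whose a-precededness differs from that of the last occurrence of w.
  LastSwitch : Bool → C → List C → ℕ → Set
  LastSwitch b a w k = (∃ λ s* → Shortest (Occ w) s* × PrecededIf b a w s*)
                     × ∃ λ s → length s ≡ k × Shortest (λ s → Occ w s × PrecededIf (not b) a w s) s

  ¬¬-lastSwitch : ∀ b {a w s* s} → Shortest (Occ w) s* → PrecededIf b a w s* → Occ w s → PrecededIf (not b) a w s
                → ¬ ¬ ∃ λ k → k ≤ length T × LastSwitch b a w k
  ¬¬-lastSwitch b {a} {w} last pre* o pre = ¬¬-map switch (¬¬-shortest _ (o , pre))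
    where
      switch : ∃ (Shortest (λ s → Occ w s × PrecededIf (not b) a w s)) → ∃ λ k → k ≤ length T × LastSwitch b a w k
      switch (s , shortest@((o , _) , _)) =
        length s , ≤-trans (length-++-≤ʳ s {w}) (occ-length≤ o) , (_ , last , pre*) , s , refl , shortest

  lastSwitch-context-unique : ∀ b {a a' w k} → LastSwitch b a w k → LastSwitch b a' w k → a ≡ a'
  lastSwitch-context-unique true ((_ , (o* , last) , pre) , _) ((_ , (o*' , last') , pre') , _)
    with refl ← suffix-unique (occ-suffix o*) (occ-suffix o*') (≤-antisym (last o*') (last' o*)) =
    left-context-unique pre pre'
  lastSwitch-context-unique false (_ , _ , |s|≡k , (_ , pre) , _) (_ , _ , |s'|≡k , (_ , pre') , _)
    with refl ← suffix-unique (occ-suffix pre) (occ-suffix pre') (trans |s|≡k (sym |s'|≡k)) =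
    left-context-unique pre pre'

  lastSwitch-¬extension : ∀ b b' {a a' w k} y c → LastSwitch b a w k → ¬ LastSwitch b' a' (y ++ c ∷ w) k
  lastSwitch-¬extension b b' {w = w} y c (_ , s , |s|≡k , (o , pre) , least)
                                         ((s* , (o* , last) , pre*) , s' , |s'|≡k , (o' , pre') , _)
    with refl ← suffix-unique (occ-suffix o) (occ-suffix o') (trans |s|≡k (sym |s'|≡k))
    = precededIf-not b' (subst (PrecededIf b' _ _) s*≡s pre*) pre'
    where
      switched : PrecededIf (not b) _ w s*
      switched = precededIf-transport (not b) (occ-dropˡ y o') (occ-dropˡ y o*) pre
      s*≡s : s* ≡ s
      s*≡s = suffix-unique (occ-suffix o*) (occ-suffix o)
               (≤-antisym (last o') (least (occ-dropˡ (c ∷ []) (occ-dropˡ y o*) , switched)))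

  lastSwitch-injective-≤ : ∀ b {a a' w w' k} → LastSwitch b a w k → LastSwitch b a' w' k → length w ≤ length w'
                         → a ≡ a' × w ≡ w'
  lastSwitch-injective-≤ b sw@(_ , s , |s|≡k , (o , _) , _) sw'@(_ , s' , |s'|≡k , (o' , _) , _) |w|≤|w'|
    with refl , y , refl ← occ-end-align o o' (trans |s|≡k (sym |s'|≡k)) |w|≤|w'|
    with initLast y
  ... | [] = lastSwitch-context-unique b sw sw' , refl
  ... | y' ∷ʳ′ c = contradiction (subst (λ v → LastSwitch b _ v _) (++-assoc y' (c ∷ []) _) sw')
                                 (lastSwitch-¬extension b b y' c sw)

  -- k is the start of an occurrence of u X, counted from the right end of T.
  ForcedAt : List C → C → C → ℕ → Set
  ForcedAt u a x k = IsLongest T u × Preceded a (u ∷ʳ x)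
                   × ∃ λ s → Occ (a ∷ u ∷ʳ x) s × length (u ∷ʳ x ++ s) ≡ k

  forcedAt-injective-≤ : ∀ {u a x u' a' x' k} → ForcedAt u a x k → ForcedAt u' a' x' k
                       → length (u ∷ʳ x) ≤ length (u' ∷ʳ x') → ¬ ¬ (u , a , x) ≡ (u' , a' , x')
  forcedAt-injective-≤ {u} {a} {x} {u'} {a'} {x'}
                       (_ , preceded , _ , o , start) (longest' , preceded' , _ , o' , start') |m|≤|m'|
    with z , m'≡m++z ← occ-start-align (occ-dropˡ (a ∷ []) o) (occ-dropˡ (a' ∷ []) o')
                                       (trans start (sym start')) |m|≤|m'|
    with initLast z
  ... | [] with refl , refl ← ∷ʳ-injective u' u (trans m'≡m++z (++-identityʳ (u ∷ʳ x))) =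
    ¬¬-map (cong (λ a → u , a , x) ∘ left-context-unique o) (preceded' (occ-dropˡ (a ∷ []) o))
  ... | z' ∷ʳ′ c
    with refl , _ ← ∷ʳ-injective u' (u ∷ʳ x ++ z') (trans m'≡m++z (sym (++-assoc (u ∷ʳ x) z' (c ∷ [])))) =
    ⊥-elim (longest⇒¬preceded longest' (preceded-++ʳ z' preceded))

  Code : List C × C × C → Fin 3 → ℕ → Set
  Code (u , a , x) zero = ForcedAt u a x
  Code (u , a , x) (suc zero) = LastSwitch true a (u ∷ʳ x)
  Code (u , a , x) (suc (suc zero)) = LastSwitch false a (u ∷ʳ x)

  code-injective-≤ : ∀ {u a x u' a' x' k} tag → Code (u , a , x) tag k → Code (u' , a' , x') tag k
                   → length (u ∷ʳ x) ≤ length (u' ∷ʳ x') → ¬ ¬ (u , a , x) ≡ (u' , a' , x')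
  code-injective-≤ zero c c' |m|≤|m'| = forcedAt-injective-≤ c c' |m|≤|m'|
  code-injective-≤ (suc zero) c c' |m|≤|m'| =
    pure (uncurry ∷ʳ-triple-≡ (lastSwitch-injective-≤ true c c' |m|≤|m'|))
  code-injective-≤ (suc (suc zero)) c c' |m|≤|m'| =
    pure (uncurry ∷ʳ-triple-≡ (lastSwitch-injective-≤ false c c' |m|≤|m'|))

  code : ∀ {u a x s} → IsLongest T u → Occ (a ∷ u ∷ʳ x) s
       → ¬ ¬ ∃₂ λ tag k → k ≤ length T × Code (u , a , x) tag k
  code {u} {a} {x} {s₀} longest o₀ = ¬¬-shortest (Occ m) o >>= λ (s* , last) →
    ¬¬-excluded-middle {A = Occ (a ∷ m) s*} >>= λ where
      (no ¬pre*) → ¬¬-map (suc (suc zero) ,_) (¬¬-lastSwitch false last ¬pre* o o₀)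
      (yes pre*) → ¬¬-excluded-middle {A = ∃ λ s → Occ m s × ¬ Occ (a ∷ m) s} >>= λ where
        (yes (_ , o , ¬pre)) → ¬¬-map (suc zero ,_) (¬¬-lastSwitch true last pre* o ¬pre)
        (no ∄¬pre) →
          pure (zero , _ , occ-length≤ o , longest , (λ {_} o ¬pre → ∄¬pre (_ , o , ¬pre)) , s₀ , o₀ , refl)
    where
      m = u ∷ʳ x
      o = occ-dropˡ (a ∷ []) o₀

  Encodes : List C × C × C → Fin (3 * suc (length T)) → Set
  Encodes t i = ∃₂ λ (tag : Fin 3) (k : Fin (suc (length T))) → i ≡ combine tag k × Code t tag (toℕ k)

  encodes-injective : ∀ {t t' i} → Encodes t i → Encodes t' i → ¬ ¬ t ≡ t'
  encodes-injective {u , a , x} {u' , a' , x'} (tag , k , refl , c) (tag' , k' , eq , c')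
    with refl , refl ← combine-injective tag k tag' k' eq
    with ≤-total (length (u ∷ʳ x)) (length (u' ∷ʳ x'))
  ... | inj₁ |m|≤|m'| = code-injective-≤ tag c c' |m|≤|m'|
  ... | inj₂ |m'|≤|m| = ¬¬-map sym (code-injective-≤ tag c' c |m'|≤|m|)

  encode : ∀ {u a x s} → IsLongest T u → Occ (a ∷ u ∷ʳ x) s → ¬ ¬ ∃ (Encodes (u , a , x))
  encode longest o = ¬¬-map index (code longest o)
    where
      index : ∀ {t} → ∃₂ (λ tag k → k ≤ length T × Code t tag k) → ∃ (Encodes t)
      index {t} (tag , k , k≤|T| , c) =
        combine tag (fromℕ< (s≤s k≤|T|)) , tag , _ , refl ,
        subst (Code t tag) (sym (toℕ-fromℕ< (s≤s k≤|T|))) c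

module _ {A : Set} {r : ℕ} (S : MetaString A r) where
  open Occurrences S

  PointCode : List (MetaChar A r) × MetaChar A r × MetaChar A r → Fin (3 * suc (length S)) → Set
  PointCode (u , A' , X) i = ∃ λ B → A' ≡ reverse B × Encodes (u , B , X) i

  pointCode-injective : ∀ {t t' i} → PointCode t i → PointCode t' i → ¬ ¬ t ≡ t'
  pointCode-injective (_ , refl , e) (_ , refl , e') =
    ¬¬-map (cong λ (u , B , X) → u , reverse B , X) (encodes-injective e e')

  pointCode : ∀ {t} → PointsTotal S t → ¬ ¬ ∃ (PointCode t)
  pointCode (longest , B , refl , _ , p , _ , eq) =
    ¬¬-map (λ (i , e) → i , B , refl , e) (encode longest (at p eq))

lemma2 : ∃ λ (c : ℕ) → ∃ λ (d : ℕ) →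
           (A : Set) (r : ℕ) (S : MetaString A r)
           (L : List (List (MetaChar A r) × MetaChar A r × MetaChar A r)) →
           Unique L → All (PointsTotal S) L → length L ≤ c * length S + d
lemma2 = 3 , 3 , λ A r S L unique points →
  subst (length L ≤_) (trans (*-suc 3 (length S)) (+-comm 3 (3 * length S)))
    (length≤-coding (PointCode S) (pointCode-injective S) unique (All.map (pointCode S) points))
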